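{- Let $S$ be a numerical semigroup that is not irreducible. Then $$\max\big(\operatorname{SG}(S)\setminus\{\operatorname{F}(S)\}\big)=\max\Big\{x\in\mathbb{N}\setminus S \ \Big|\ \operatorname{F}(S)-x\notin S,\ x\neq \tfrac{\operatorname{F}(S)}{2}\Big\},$$ and this number is greater than $\frac{\operatorname{F}(S)}{2}$.
   Context: $\mathbb{N}=\{0,1,2,\ldots\}$. A numerical semigroup is a submonoid $S$ of $(\mathbb{N},+)$ with $\mathbb{N}\setminus S$ finite. $\operatorname{H}(S)=\mathbb{N}\setminus S$; $\operatorname{F}(S)=\max\operatorname{H}(S)$. Special gaps: $\operatorname{SG}(S)=\{h\in\operatorname{H}(S)\mid 2h\in S \text{ and } h+s\in S \text{ for all } s\in S\setminus\{0\}\}$. $S$ is irreducible if it cannot be written as the intersection of two numerical semigroups properly containing $S$. -}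

module Defs where

open import Data.Nat using (ℕ; zero; suc; _+_; _*_; _∸_; _≤_; _<_)
open import Data.Bool using (Bool; true; false)
open import Data.Product using (Σ; ∃; ∃-syntax; _×_; _,_)
open import Relation.Nullary using (¬_)
open import Relation.Binary.PropositionalEquality using (_≡_)

-- A subset of ℕ, given by its (decidable) characteristic function.
-- Every numerical semigroup has finite complement, hence is decidable.
Subset : Set
Subset = ℕ → Bool

_∈_ : ℕ → Subset → Set
x ∈ S = S x ≡ true

_∉_ : ℕ → Subset → Set
x ∉ S = ¬ (x ∈ S)

record IsNumericalSemigroup (S : Subset) : Set where
  field
    zero∈     : 0 ∈ S
    +-closed  : ∀ x y → x ∈ S → y ∈ S → (x + y) ∈ S
    cofinite  : ∃[ N ] (∀ n → N ≤ n → n ∈ S)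

_⊂_ : Subset → Subset → Set
S ⊂ T = (∀ x → x ∈ S → x ∈ T) × (∃[ x ] (x ∈ T × x ∉ S))

Irreducible : Subset → Set
Irreducible S =
  ¬ (Σ Subset λ T → Σ Subset λ U →
       IsNumericalSemigroup T × IsNumericalSemigroup U ×
       S ⊂ T × S ⊂ U ×
       (∀ x → (x ∈ S → (x ∈ T × x ∈ U)) × ((x ∈ T × x ∈ U) → x ∈ S)))

Gap : Subset → ℕ → Set
Gap S h = h ∉ S

IsMax : (ℕ → Set) → ℕ → Set
IsMax P m = P m × (∀ y → P y → y ≤ m)

IsFrobenius : Subset → ℕ → Set
IsFrobenius S f = IsMax (Gap S) f

SpecialGap : Subset → ℕ → Set
SpecialGap S h =
  Gap S h × (h + h) ∈ S × (∀ s → s ∈ S → ¬ (s ≡ 0) → (h + s) ∈ S)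

-- Call x a twin gap if x and F − x are both gaps and x ≠ F/2. If S has no twin gap,
-- every gap x ≠ F/2 has F − x ∈ S, so any numerical semigroup properly containing S
-- contains F; an intersection of two of them then contains F, so S is irreducible.
-- Hence a reducible S has a largest twin gap m. Twin gaps come in pairs {x, F − x},
-- so F − m ≤ m, i.e. F < 2m, which puts 2m in S. If m + s were a gap for some s ∈ S,
-- then F − (m + s) would be a gap too (adding s to it gives F − m), making m + s a
-- larger twin gap; so m is special. Conversely a special gap h ≠ F is a twin gap,
-- because h + (F − h) = F ∉ S forces F − h ∉ S.
module Submission where

open import Defs
open import Level using (0ℓ)
open import Data.Bool using (true) renaming (_≟_ to _≟ᵇ_)
open import Data.Nat using (ℕ; zero; suc; _+_; _∸_; _<_; _≤_; z≤n; s≤s⁻¹; _≟_)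
open import Data.Nat.Properties
open import Data.Product using (∃-syntax; _×_; _,_; proj₁; proj₂)
open import Data.Sum using (_⊎_; inj₁; inj₂)
open import Data.Empty using (⊥-elim)
open import Relation.Nullary using (¬_; Dec; yes; no)
open import Relation.Nullary.Decidable using (¬?; _×-dec_; decidable-stable)
open import Relation.Unary using (Pred; Decidable)
open import Relation.Binary.PropositionalEquality
  using (_≡_; _≢_; refl; sym; trans; cong; subst; module ≡-Reasoning)

≤-pred-unless : ∀ (P : Pred ℕ 0ℓ) {n y} → ¬ P (suc n) → y ≤ suc n → P y → y ≤ n
≤-pred-unless P ¬p y≤1+n py = s≤s⁻¹ (≤∧≢⇒< y≤1+n λ y≡1+n → ¬p (subst P y≡1+n py))

MaxUpTo : Pred ℕ 0ℓ → ℕ → ℕ → Set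
MaxUpTo P n m = m ≤ n × P m × (∀ y → y ≤ n → P y → y ≤ m)

maxUpTo : {P : Pred ℕ 0ℓ} → Decidable P → ∀ n →
          (∃[ m ] MaxUpTo P n m) ⊎ (∀ y → y ≤ n → ¬ P y)
maxUpTo {P} P? zero with P? zero
... | yes p = inj₁ (zero , z≤n , p , λ y y≤0 _ → y≤0)
... | no ¬p = inj₂ λ y y≤0 py → ¬p (subst P (n≤0⇒n≡0 y≤0) py)
maxUpTo {P} P? (suc n) with P? (suc n)
... | yes p = inj₁ (suc n , ≤-refl , p , λ _ y≤n _ → y≤n)
... | no ¬p with maxUpTo P? n
...   | inj₁ (m , m≤n , pm , max) =
        inj₁ (m , m≤n⇒m≤1+n m≤n , pm , λ y y≤1+n py → max y (≤-pred-unless P ¬p y≤1+n py) py)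
...   | inj₂ none = inj₂ λ y y≤1+n py → none y (≤-pred-unless P ¬p y≤1+n py) py

_∈?_ : ∀ x S → Dec (x ∈ S)
x ∈? S = S x ≟ᵇ true

∉-stable : ∀ {x} S → ¬ x ∉ S → x ∈ S
∉-stable {x} S = decidable-stable (x ∈? S)

double-∸≡⇒double≡ : ∀ {x F} → x ≤ F → (F ∸ x) + (F ∸ x) ≡ F → x + x ≡ F
double-∸≡⇒double≡ {x} {F} x≤F eq = begin
  x + x       ≡⟨ cong (x +_) (sym F∸x≡x) ⟩
  x + (F ∸ x) ≡⟨ m+[n∸m]≡n x≤F ⟩
  F           ∎
  where
  open ≡-Reasoning
  F∸x≡x : F ∸ x ≡ x
  F∸x≡x = +-cancelˡ-≡ (F ∸ x) _ _ (trans eq (sym (m∸n+n≡m x≤F)))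

∸[+]+≡∸ : ∀ {F} x s → x + s ≤ F → F ∸ (x + s) + s ≡ F ∸ x
∸[+]+≡∸ {F} x s x+s≤F = begin
  F ∸ (x + s) + s ≡⟨ cong (_+ s) (sym (∸-+-assoc F x s)) ⟩
  F ∸ x ∸ s + s   ≡⟨ m∸n+n≡m (m+n≤o⇒m≤o∸n s (subst (_≤ F) (+-comm x s) x+s≤F)) ⟩
  F ∸ x           ∎
  where open ≡-Reasoning

module Frobenius (S : Subset) (S-numerical : IsNumericalSemigroup S)
                 (F : ℕ) (S-frobenius : IsFrobenius S F) where

  open IsNumericalSemigroup S-numerical

  private
    F∉S : F ∉ S
    F∉S = proj₁ S-frobenius

    gap⇒≤F : ∀ {x} → x ∉ S → x ≤ F
    gap⇒≤F {x} = proj₂ S-frobenius x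

  >F⇒∈ : ∀ {n} → F < n → n ∈ S
  >F⇒∈ F<n = ∉-stable S λ n∉S → <⇒≱ F<n (gap⇒≤F n∉S)

  TwinGap : ℕ → Set
  TwinGap x = Gap S x × (F ∸ x) ∉ S × x + x ≢ F

  twinGap? : Decidable TwinGap
  twinGap? x = ¬? (x ∈? S) ×-dec (¬? ((F ∸ x) ∈? S) ×-dec ¬? (x + x ≟ F))

  twinGap-reflect : ∀ {x} → TwinGap x → TwinGap (F ∸ x)
  twinGap-reflect {x} (x∉S , F∸x∉S , x+x≢F) =
    F∸x∉S , subst (_∉ S) (sym (m∸[m∸n]≡n x≤F)) x∉S , λ eq → x+x≢F (double-∸≡⇒double≡ x≤F eq)
    where
    x≤F : x ≤ F
    x≤F = gap⇒≤F x∉S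

  twinGap-free⇒F∈overSemigroup : (∀ x → ¬ TwinGap x) →
    ∀ T → IsNumericalSemigroup T → S ⊂ T → F ∈ T
  twinGap-free⇒F∈overSemigroup noTwin T T-numerical (S⊆T , x , x∈T , x∉S) with x + x ≟ F
  ... | yes x+x≡F = subst (_∈ T) x+x≡F (T.+-closed x x x∈T x∈T)
    where module T = IsNumericalSemigroup T-numerical
  ... | no x+x≢F =
    subst (_∈ T) (m+[n∸m]≡n (gap⇒≤F x∉S)) (T.+-closed x (F ∸ x) x∈T (S⊆T _ F∸x∈S))
    where
    module T = IsNumericalSemigroup T-numerical
    F∸x∈S : (F ∸ x) ∈ S
    F∸x∈S = ∉-stable S λ F∸x∉S → noTwin x (x∉S , F∸x∉S , x+x≢F)

  twinGap-free⇒irreducible : (∀ x → ¬ TwinGap x) → Irreducible S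
  twinGap-free⇒irreducible noTwin (T , U , T-numerical , U-numerical , S⊂T , S⊂U , S≡T∩U) =
    F∉S (proj₂ (S≡T∩U F) (F∈ T T-numerical S⊂T , F∈ U U-numerical S⊂U))
    where
    F∈ : ∀ T → IsNumericalSemigroup T → S ⊂ T → F ∈ T
    F∈ = twinGap-free⇒F∈overSemigroup noTwin

  maximalTwinGap : ¬ Irreducible S → ∃[ m ] IsMax TwinGap m
  maximalTwinGap reducible with maxUpTo twinGap? F
  ... | inj₁ (m , _ , m-twin , m-max) =
    m , m-twin , λ x x-twin → m-max x (gap⇒≤F (proj₁ x-twin)) x-twin
  ... | inj₂ none =
    ⊥-elim (reducible (twinGap-free⇒irreducible λ x x-twin → none x (gap⇒≤F (proj₁ x-twin)) x-twin))

  specialGap⇒twinGap : ∀ {h} → SpecialGap S h → h ≢ F → TwinGap h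
  specialGap⇒twinGap {h} (h∉S , h+h∈S , h+S⊆S) h≢F =
    h∉S , F∸h∉S , λ h+h≡F → F∉S (subst (_∈ S) h+h≡F h+h∈S)
    where
    h≤F : h ≤ F
    h≤F = gap⇒≤F h∉S
    F∸h∉S : (F ∸ h) ∉ S
    F∸h∉S F∸h∈S = F∉S (subst (_∈ S) (m+[n∸m]≡n h≤F)
      (h+S⊆S (F ∸ h) F∸h∈S λ F∸h≡0 → h≢F (≤-antisym h≤F (m∸n≡0⇒m≤n F∸h≡0))))

  module MaximalTwinGap (m : ℕ) (m-max : IsMax TwinGap m) where

    private
      m-twin : TwinGap m
      m-twin = proj₁ m-max

      m∉S : m ∉ S
      m∉S = proj₁ m-twin

      F∸m∉S : (F ∸ m) ∉ S
      F∸m∉S = proj₁ (proj₂ m-twin)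

      m+m≢F : m + m ≢ F
      m+m≢F = proj₂ (proj₂ m-twin)

      m≤F : m ≤ F
      m≤F = gap⇒≤F m∉S

    F<m+m : F < m + m
    F<m+m = ≤∧≢⇒< (subst (_≤ m + m) (m+[n∸m]≡n m≤F) (+-monoʳ-≤ m F∸m≤m))
                  (λ F≡m+m → m+m≢F (sym F≡m+m))
      where
      F∸m≤m : F ∸ m ≤ m
      F∸m≤m = proj₂ m-max (F ∸ m) (twinGap-reflect m-twin)

    m≢F : m ≢ F
    m≢F m≡F = F∸m∉S (subst (λ z → (F ∸ z) ∈ S) (sym m≡F) (subst (_∈ S) (sym (n∸n≡0 F)) zero∈))

    m+s∈S : ∀ s → s ∈ S → s ≢ 0 → (m + s) ∈ S
    m+s∈S s s∈S s≢0 =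
      ∉-stable S λ m+s∉S → <⇒≱ (m<m+n m 0<s) (proj₂ m-max (m + s) (m+s-twin m+s∉S))
      where
      0<s : 0 < s
      0<s = n≢0⇒n>0 s≢0
      m+s-twin : (m + s) ∉ S → TwinGap (m + s)
      m+s-twin m+s∉S = m+s∉S , F∸[m+s]∉S , λ eq → <⇒≢ F<2[m+s] (sym eq)
        where
        F∸[m+s]∉S : (F ∸ (m + s)) ∉ S
        F∸[m+s]∉S F∸[m+s]∈S =
          F∸m∉S (subst (_∈ S) (∸[+]+≡∸ m s (gap⇒≤F m+s∉S)) (+-closed _ s F∸[m+s]∈S s∈S))
        F<2[m+s] : F < (m + s) + (m + s)
        F<2[m+s] = <-≤-trans F<m+m (+-mono-≤ (m≤m+n m s) (m≤m+n m s))

    m-special : SpecialGap S m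
    m-special = m∉S , >F⇒∈ F<m+m , m+s∈S

    m-maxSpecial : IsMax (λ h → SpecialGap S h × h ≢ F) m
    m-maxSpecial = (m-special , m≢F) , λ h (h-special , h≢F) →
      proj₂ m-max h (specialGap⇒twinGap h-special h≢F)

lemma4p2 : (S : Subset) → IsNumericalSemigroup S → ¬ Irreducible S →
    (F : ℕ) → IsFrobenius S F →
    ∃[ m ] (IsMax (λ h → SpecialGap S h × ¬ (h ≡ F)) m
           × IsMax (λ x → Gap S x × (F ∸ x) ∉ S × ¬ (x + x ≡ F)) m
           × F < m + m)
lemma4p2 S S-numerical reducible F S-frobenius =
  let open Frobenius S S-numerical F S-frobenius
      m , m-max = maximalTwinGap reducible
      open MaximalTwinGap m m-max
  in m , m-maxSpecial , m-max , F<m+m
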